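{- Let $G$ be the set of nonzero vectors of a finite-dimensional $\mathbb F_2$-vector space, and let $(P,Q,R)$ be a partition of $G$ (parts possibly empty) such that no triangle $T$ of $G$ satisfies $|T\cap P|\ge1$ and $|T\cap R|=1$. Then $\mathrm{cl}(P)\subseteq P\cup Q$, and every coset of $\mathrm{cl}(P)$ in $G$ is contained in $Q$ or in $R$. Furthermore, if $(R_1,R_2)$ is a partition of $R$ such that no triangle of $G$ intersects all three of $P$, $R_1$ and $R_2$, then every coset of $\mathrm{cl}(P)$ in $G$ is contained in $Q$, in $R_1$ or in $R_2$.
   Context: A flat of $G$ is a set $F\subseteq G$ such that $F\cup\{0\}$ is a subspace; a triangle is a $2$-dimensional flat, i.e. a set $\{x,y,x+y\}$ with $x\ne y$ in $G$. $\mathrm{cl}(X)$ is the set of nonzero vectors in the span of $X$ (so $\mathrm{cl}(\varnothing)=\varnothing$). A coset of a flat $F$ in $G$ is a set $x+(F\cup\{0\})$ with $x\in G\setminus F$. -}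

module Defs where

open import Data.Bool using (Bool; true; false; _xor_; _∨_; _∧_)
open import Data.Nat using (ℕ; zero; suc; _+_; _≥_)
open import Data.Vec using (Vec; zipWith; replicate)
open import Data.List using (List; []; _∷_; foldr; sum; map)
open import Data.List.Relation.Unary.All using (All)
open import Data.Product using (Σ; _×_; ∃)
open import Data.Sum using (_⊎_)
open import Relation.Binary.PropositionalEquality using (_≡_; _≢_)
open import Relation.Nullary using (¬_)

-- The F₂-vector space F₂ⁿ (every finite-dimensional F₂-space is ≅ F₂ⁿ).
V : ℕ → Set
V n = Vec Bool n

0v : ∀ {n} → V n
0v = replicate _ false

infixl 6 _⊕_
_⊕_ : ∀ {n} → V n → V n → V n
_⊕_ = zipWith _xor_

InG : ∀ {n} → V n → Set
InG v = v ≢ 0v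

Subset : ℕ → Set
Subset n = V n → Bool

_∈ˢ_ : ∀ {n} → V n → Subset n → Set
v ∈ˢ S = S v ≡ true

ind : Bool → ℕ
ind true = 1
ind false = 0

-- (P,Q,R) is a partition of G (parts possibly empty):
-- each of P,Q,R ⊆ G and each element of G lies in exactly one part.
IsPartition3 : ∀ {n} → Subset n → Subset n → Subset n → Set
IsPartition3 {n} P Q R =
  (∀ (v : V n) → InG v → ind (P v) + ind (Q v) + ind (R v) ≡ 1) ×
  (ind (P 0v) + ind (Q 0v) + ind (R 0v) ≡ 0)

IsPartition2Of : ∀ {n} → Subset n → Subset n → Subset n → Set
IsPartition2Of {n} R R₁ R₂ =
  ∀ (v : V n) → ind (R₁ v) + ind (R₂ v) ≡ ind (R v)

-- The triangle {x, y, x+y} (x ≠ y in G) and |T ∩ S|.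
IsTriangle : ∀ {n} → V n → V n → Set
IsTriangle x y = InG x × InG y × x ≢ y

triCount : ∀ {n} → Subset n → V n → V n → ℕ
triCount S x y = ind (S x) + ind (S y) + ind (S (x ⊕ y))

InSpan : ∀ {n} → Subset n → V n → Set
InSpan {n} X v = Σ (List (V n)) λ xs → All (λ u → u ∈ˢ X) xs × foldr _⊕_ 0v xs ≡ v

InCl : ∀ {n} → Subset n → V n → Set
InCl X v = InG v × InSpan X v

IsCosetRep : ∀ {n} → Subset n → V n → Set
IsCosetRep X x = InG x × ¬ InCl X x

InCoset : ∀ {n} → Subset n → V n → V n → Set
InCoset {n} X x v = Σ (V n) λ w → (w ≡ 0v ⊎ InCl X w) × v ≡ x ⊕ w

CosetIn : ∀ {n} → Subset n → V n → Subset n → Set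
CosetIn {n} X x S = ∀ (v : V n) → InCoset X x v → v ∈ˢ S

-- For p ∈ P and y outside the span of P, the triangle {p, y, p + y} meets P
-- while p ∉ R, so the hypothesis forces y and p + y to lie both in R or both
-- outside it: membership in R is invariant under translation by P away from
-- the span. Adding the elements of P one at a time, R is therefore constant on
-- every coset of cl(P), and the same argument started at a single p ∈ P shows
-- that cl(P) misses R. Given the split (R₁, R₂), a triangle {p, y, p + y} with
-- y ∈ R₁ and p + y ∈ R₂ would meet P, R₁ and R₂, so R₁ is invariant as well.
module Submission where

open import Defs
open import Data.Bool using (true; false)
open import Data.Bool.Properties
  using (xor-assoc; xor-comm; xor-identityˡ; xor-identityʳ; xor-same)
  renaming (_≟_ to _≟ᵇ_)
open import Data.Nat using (ℕ; _≥_; _+_; s≤s; z≤n)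
open import Data.Vec using ([]; _∷_)
open import Data.Vec.Properties
  using (zipWith-assoc; zipWith-comm; zipWith-identityˡ; zipWith-identityʳ)
import Data.Vec.Properties as Vec
open import Data.List using ([]; _∷_; foldr)
open import Data.List.Relation.Unary.All using (All; []; _∷_)
open import Data.Product using (Σ; _×_; _,_; proj₁; proj₂)
open import Data.Sum using (_⊎_; inj₁; inj₂)
open import Data.Empty using (⊥-elim)
open import Function using (_∘_)
open import Relation.Binary.PropositionalEquality
open import Relation.Nullary using (¬_; yes; no)

⊕-self : ∀ {n} (x : V n) → x ⊕ x ≡ 0v
⊕-self []      = refl
⊕-self (a ∷ x) = cong₂ _∷_ (xor-same a) (⊕-self x)

module _ {n : ℕ} where

  ⊕-assoc : (x y z : V n) → (x ⊕ y) ⊕ z ≡ x ⊕ (y ⊕ z)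
  ⊕-assoc = zipWith-assoc xor-assoc

  ⊕-comm : (x y : V n) → x ⊕ y ≡ y ⊕ x
  ⊕-comm = zipWith-comm xor-comm

  ⊕-identityˡ : (x : V n) → 0v ⊕ x ≡ x
  ⊕-identityˡ = zipWith-identityˡ xor-identityˡ

  ⊕-identityʳ : (x : V n) → x ⊕ 0v ≡ x
  ⊕-identityʳ = zipWith-identityʳ xor-identityʳ

  ⊕-cancelʳ : (y w : V n) → (y ⊕ w) ⊕ w ≡ y
  ⊕-cancelʳ y w = begin
    (y ⊕ w) ⊕ w  ≡⟨ ⊕-assoc y w w ⟩
    y ⊕ (w ⊕ w)  ≡⟨ cong (y ⊕_) (⊕-self w) ⟩
    y ⊕ 0v       ≡⟨ ⊕-identityʳ y ⟩
    y            ∎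
    where open ≡-Reasoning

  ⊕-swap : (x p w : V n) → x ⊕ (p ⊕ w) ≡ p ⊕ (x ⊕ w)
  ⊕-swap x p w = begin
    x ⊕ (p ⊕ w)  ≡⟨ sym (⊕-assoc x p w) ⟩
    (x ⊕ p) ⊕ w  ≡⟨ cong (_⊕ w) (⊕-comm x p) ⟩
    (p ⊕ x) ⊕ w  ≡⟨ ⊕-assoc p x w ⟩
    p ⊕ (x ⊕ w)  ∎
    where open ≡-Reasoning

  ≡⇒⊕≡0 : {x y : V n} → x ≡ y → x ⊕ y ≡ 0v
  ≡⇒⊕≡0 {x} refl = ⊕-self x

ind-sum-pos : ∀ a b c → a ≡ true ⊎ b ≡ true ⊎ c ≡ true → ind a + ind b + ind c ≥ 1
ind-sum-pos true  _     _    _                = s≤s z≤n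
ind-sum-pos false true  _    _                = s≤s z≤n
ind-sum-pos false false true _                = s≤s z≤n
ind-sum-pos false false false (inj₁ ())
ind-sum-pos false false false (inj₂ (inj₁ ()))
ind-sum-pos false false false (inj₂ (inj₂ ()))

ind-sum≡1 : ∀ a b c → a ≡ false → b ≢ c → ind a + ind b + ind c ≡ 1
ind-sum≡1 false true  false refl _  = refl
ind-sum≡1 false false true  refl _  = refl
ind-sum≡1 false true  true  refl ne = ⊥-elim (ne refl)
ind-sum≡1 false false false refl ne = ⊥-elim (ne refl)

ind-sum≡0⇒first≢true : ∀ a b c → ind a + ind b + ind c ≡ 0 → a ≢ true
ind-sum≡0⇒first≢true false _ _ _ ()

ind-sum≡1⇒first⇒¬third : ∀ a b c → ind a + ind b + ind c ≡ 1 → a ≡ true → c ≡ false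
ind-sum≡1⇒first⇒¬third true false false _ _ = refl
ind-sum≡1⇒first⇒¬third true true  _     () _
ind-sum≡1⇒first⇒¬third true false true  () _

ind-sum≡1⇒¬third⇒first⊎second :
  ∀ a b c → ind a + ind b + ind c ≡ 1 → c ≡ false → a ≡ true ⊎ b ≡ true
ind-sum≡1⇒¬third⇒first⊎second true  _     _     _  _    = inj₁ refl
ind-sum≡1⇒¬third⇒first⊎second false true  _     _  _    = inj₂ refl
ind-sum≡1⇒¬third⇒first⊎second false false false () refl

ind-split⇒first⇒whole : ∀ a b c → ind a + ind b ≡ ind c → a ≡ true → c ≡ true
ind-split⇒first⇒whole true false true  _ _ = refl
ind-split⇒first⇒whole true true  false () _
ind-split⇒first⇒whole true false false () _

ind-split⇒whole⇒¬first⇒second : ∀ a b c → ind a + ind b ≡ ind c → c ≡ true → a ≡ false → b ≡ true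
ind-split⇒whole⇒¬first⇒second false true  true _  _ _ = refl
ind-split⇒whole⇒¬first⇒second false false true () _ _

module _ {n : ℕ} {X : Subset n} where

  span-0 : InSpan X 0v
  span-0 = [] , [] , refl

  span-∷ : {x w : V n} → x ∈ˢ X → InSpan X w → InSpan X (x ⊕ w)
  span-∷ {x} x∈ (xs , xs⊆ , refl) = x ∷ xs , x∈ ∷ xs⊆ , refl

  span-∈ : {x : V n} → x ∈ˢ X → InSpan X x
  span-∈ {x} x∈ = subst (InSpan X) (⊕-identityʳ x) (span-∷ x∈ span-0)

  span-ind : (Pr : V n → Set) → Pr 0v →
    (∀ {x w} → x ∈ˢ X → InSpan X w → Pr w → Pr (x ⊕ w)) →
    ∀ {v} → InSpan X v → Pr v
  span-ind Pr base step (_ , xs⊆ , refl) = go xs⊆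
    where
    go : ∀ {xs} → All (_∈ˢ X) xs → Pr (foldr _⊕_ 0v xs)
    go []         = base
    go (x∈ ∷ xs⊆) = step x∈ (_ , xs⊆ , refl) (go xs⊆)

  span-⊕ : {u w : V n} → InSpan X u → InSpan X w → InSpan X (u ⊕ w)
  span-⊕ {w = w} u∈ w∈ = span-ind (λ u → InSpan X (u ⊕ w))
    (subst (InSpan X) (sym (⊕-identityˡ w)) w∈)
    (λ {x} {u} x∈ _ uw∈ → subst (InSpan X) (sym (⊕-assoc x u w)) (span-∷ x∈ uw∈))
    u∈

  ∉span-⊕ : {y w : V n} → ¬ InSpan X y → InSpan X w → ¬ InSpan X (y ⊕ w)
  ∉span-⊕ {y} {w} y∉ w∈ yw∈ = y∉ (subst (InSpan X) (⊕-cancelʳ y w) (span-⊕ yw∈ w∈))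

  ∉span⇒InG : {y : V n} → ¬ InSpan X y → InG y
  ∉span⇒InG y∉ refl = y∉ span-0

  triangle-off-span : {p y : V n} → InG p → p ∈ˢ X → ¬ InSpan X y → IsTriangle p y
  triangle-off-span p≢0 p∈ y∉ =
    p≢0 , ∉span⇒InG y∉ , λ { refl → y∉ (span-∈ p∈) }

  coset-rep-∉span : {x : V n} → IsCosetRep X x → ¬ InSpan X x
  coset-rep-∉span (x≢0 , x∉cl) x∈ = x∉cl (x≢0 , x∈)

  coset-translate : {x v : V n} → InCoset X x v → Σ (V n) λ w → InSpan X w × v ≡ x ⊕ w
  coset-translate (w , inj₁ refl , v≡) = 0v , span-0 , v≡
  coset-translate (w , inj₂ (_ , w∈) , v≡) = w , w∈ , v≡

  coset-∉span : {x v : V n} → IsCosetRep X x → InCoset X x v → ¬ InSpan X v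
  coset-∉span rep c with coset-translate c
  ... | w , w∈ , refl = ∉span-⊕ (coset-rep-∉span rep) w∈

  InvariantOffSpan : Subset n → Set
  InvariantOffSpan f = ∀ {p y} → p ∈ˢ X → ¬ InSpan X y → f (p ⊕ y) ≡ f y

  coset-constant : {f : Subset n} {x v : V n} → InvariantOffSpan f →
    IsCosetRep X x → InCoset X x v → f v ≡ f x
  coset-constant {f} {x} inv rep c with coset-translate c
  ... | w , w∈ , refl = span-ind (λ w → f (x ⊕ w) ≡ f x)
    (cong f (⊕-identityʳ x))
    (λ {p} {w} p∈ w∈ fxw≡fx → begin
      f (x ⊕ (p ⊕ w))  ≡⟨ cong f (⊕-swap x p w) ⟩
      f (p ⊕ (x ⊕ w))  ≡⟨ inv p∈ (∉span-⊕ (coset-rep-∉span rep) w∈) ⟩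
      f (x ⊕ w)        ≡⟨ fxw≡fx ⟩
      f x              ∎)
    w∈
    where open ≡-Reasoning

module _ {n : ℕ} {P Q R : Subset n} (partition : IsPartition3 P Q R)
  (no-P-R-once : ∀ x y → IsTriangle x y → ¬ (triCount P x y ≥ 1 × triCount R x y ≡ 1))
  where

  P⊆G : {p : V n} → p ∈ˢ P → InG p
  P⊆G p∈ refl = ind-sum≡0⇒first≢true _ _ _ (proj₂ partition) p∈

  P⇒¬R : {p : V n} → p ∈ˢ P → R p ≡ false
  P⇒¬R {p} p∈ = ind-sum≡1⇒first⇒¬third (P p) (Q p) (R p) (proj₁ partition p (P⊆G p∈)) p∈

  ∉span⇒¬R⇒Q : {v : V n} → ¬ InSpan P v → R v ≡ false → v ∈ˢ Q
  ∉span⇒¬R⇒Q {v} v∉ v∉R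
    with ind-sum≡1⇒¬third⇒first⊎second (P v) (Q v) (R v) (proj₁ partition v (∉span⇒InG v∉)) v∉R
  ... | inj₁ v∈P = ⊥-elim (v∉ (span-∈ v∈P))
  ... | inj₂ v∈Q = v∈Q

  R-translate : {p y : V n} → p ∈ˢ P → IsTriangle p y → R (p ⊕ y) ≡ R y
  R-translate {p} {y} p∈ t with R (p ⊕ y) ≟ᵇ R y
  ... | yes eq = eq
  ... | no neq = ⊥-elim (no-P-R-once p y t
    ( ind-sum-pos (P p) (P y) (P (p ⊕ y)) (inj₁ p∈)
    , ind-sum≡1 (R p) (R y) (R (p ⊕ y)) (P⇒¬R p∈) (neq ∘ sym)))

  R-invariant : InvariantOffSpan R
  R-invariant p∈ y∉ = R-translate p∈ (triangle-off-span (P⊆G p∈) p∈ y∉)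

  span-∩-G-avoids-R : {s : V n} → InSpan P s → InG s → R s ≡ false
  span-∩-G-avoids-R = span-ind (λ s → InG s → R s ≡ false)
    (λ 0≢0 → ⊥-elim (0≢0 refl))
    step
    where
    step : ∀ {p t} → p ∈ˢ P → InSpan P t → (InG t → R t ≡ false) → InG (p ⊕ t) → R (p ⊕ t) ≡ false
    step {p} {t} p∈ _ ih pt≢0 with Vec.≡-dec _≟ᵇ_ t 0v
    ... | yes refl = trans (cong R (⊕-identityʳ p)) (P⇒¬R p∈)
    ... | no t≢0 =
      trans (R-translate p∈ (P⊆G p∈ , t≢0 , pt≢0 ∘ ≡⇒⊕≡0)) (ih t≢0)

  cl-⊆-P∪Q : ∀ v → InCl P v → v ∈ˢ P ⊎ v ∈ˢ Q
  cl-⊆-P∪Q v (v≢0 , v∈) = ind-sum≡1⇒¬third⇒first⊎second (P v) (Q v) (R v)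
    (proj₁ partition v v≢0) (span-∩-G-avoids-R v∈ v≢0)

  coset-⊆-Q⊎R : ∀ x → IsCosetRep P x → CosetIn P x Q ⊎ CosetIn P x R
  coset-⊆-Q⊎R x rep with R x in Rx
  ... | true  = inj₂ λ v c → trans (coset-constant R-invariant rep c) Rx
  ... | false = inj₁ λ v c →
    ∉span⇒¬R⇒Q (coset-∉span rep c) (trans (coset-constant R-invariant rep c) Rx)

  module _ {R₁ R₂ : Subset n} (split : IsPartition2Of R R₁ R₂)
    (no-P-R₁-R₂ : ∀ x y → IsTriangle x y →
      ¬ (triCount P x y ≥ 1 × triCount R₁ x y ≥ 1 × triCount R₂ x y ≥ 1))
    where

    R₁⇒R : {v : V n} → R₁ v ≡ true → R v ≡ true
    R₁⇒R {v} = ind-split⇒first⇒whole (R₁ v) (R₂ v) (R v) (split v)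

    R∖R₁⇒R₂ : {v : V n} → R v ≡ true → R₁ v ≡ false → R₂ v ≡ true
    R∖R₁⇒R₂ {v} = ind-split⇒whole⇒¬first⇒second (R₁ v) (R₂ v) (R v) (split v)

    R₁-translate : {p y : V n} → p ∈ˢ P → IsTriangle p y → R₁ (p ⊕ y) ≡ R₁ y
    R₁-translate {p} {y} p∈ t with R₁ (p ⊕ y) in R₁z | R₁ y in R₁y
    ... | true  | true  = refl
    ... | false | false = refl
    ... | true  | false = ⊥-elim (no-P-R₁-R₂ p y t
      ( ind-sum-pos (P p) (P y) (P (p ⊕ y)) (inj₁ p∈)
      , ind-sum-pos (R₁ p) (R₁ y) (R₁ (p ⊕ y)) (inj₂ (inj₂ R₁z))
      , ind-sum-pos (R₂ p) (R₂ y) (R₂ (p ⊕ y))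
          (inj₂ (inj₁ (R∖R₁⇒R₂ (trans (sym (R-translate p∈ t)) (R₁⇒R R₁z)) R₁y)))))
    ... | false | true  = ⊥-elim (no-P-R₁-R₂ p y t
      ( ind-sum-pos (P p) (P y) (P (p ⊕ y)) (inj₁ p∈)
      , ind-sum-pos (R₁ p) (R₁ y) (R₁ (p ⊕ y)) (inj₂ (inj₁ R₁y))
      , ind-sum-pos (R₂ p) (R₂ y) (R₂ (p ⊕ y))
          (inj₂ (inj₂ (R∖R₁⇒R₂ (trans (R-translate p∈ t) (R₁⇒R R₁y)) R₁z)))))

    R₁-invariant : InvariantOffSpan R₁
    R₁-invariant p∈ y∉ = R₁-translate p∈ (triangle-off-span (P⊆G p∈) p∈ y∉)

    coset-⊆-Q⊎R₁⊎R₂ : ∀ x → IsCosetRep P x → CosetIn P x Q ⊎ (CosetIn P x R₁ ⊎ CosetIn P x R₂)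
    coset-⊆-Q⊎R₁⊎R₂ x rep with coset-⊆-Q⊎R x rep | R₁ x in R₁x
    ... | inj₁ ⊆Q | _     = inj₁ ⊆Q
    ... | inj₂ _  | true  = inj₂ (inj₁ λ v c → trans (coset-constant R₁-invariant rep c) R₁x)
    ... | inj₂ ⊆R | false = inj₂ (inj₂ λ v c →
      R∖R₁⇒R₂ (⊆R v c) (trans (coset-constant R₁-invariant rep c) R₁x))

lemma2p14 : (n : ℕ) (P Q R : Subset n) → IsPartition3 P Q R →
    (∀ x y → IsTriangle x y → ¬ (triCount P x y ≥ 1 × triCount R x y ≡ 1)) →
    (∀ v → InCl P v → v ∈ˢ P ⊎ v ∈ˢ Q) ×
    (∀ x → IsCosetRep P x → CosetIn P x Q ⊎ CosetIn P x R) ×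
    ((R₁ R₂ : Subset n) → IsPartition2Of R R₁ R₂ →
      (∀ x y → IsTriangle x y →
        ¬ (triCount P x y ≥ 1 × triCount R₁ x y ≥ 1 × triCount R₂ x y ≥ 1)) →
      ∀ x → IsCosetRep P x → CosetIn P x Q ⊎ (CosetIn P x R₁ ⊎ CosetIn P x R₂))
lemma2p14 n P Q R partition no-P-R-once =
    cl-⊆-P∪Q partition no-P-R-once
  , coset-⊆-Q⊎R partition no-P-R-once
  , λ R₁ R₂ split no-P-R₁-R₂ → coset-⊆-Q⊎R₁⊎R₂ partition no-P-R-once split no-P-R₁-R₂
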